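{- For any graph $G$ and any integer $\ell\geq 0$, $\operatorname{Z}_{(\ell)}(G)=\operatorname{Z}_{(\ell)}^m(G)$. In particular, a set $B\subseteq V(G)$ is an $\ell$-leaky forcing set of $G$ if and only if $B$ is a mixed $\ell$-leaky forcing set of $G$.
   Context: All graphs are finite simple graphs. Given a graph $G$ and a set $B\subseteq V(G)$ of initially blue vertices (all other vertices white), the zero forcing color-change rule says: if a blue vertex $u$ has exactly one white neighbor $w$, then $u$ may force $w$ (written $u\rightarrow w$). A vertex leak is a vertex not allowed to perform any force; $B$ is an $\ell$-leaky forcing set if for every set of $\ell$ vertex leaks, exhaustively applying the color-change rule from $B$ (with leaks never forcing) turns all of $G$ blue, and $\operatorname{Z}_{(\ell)}(G)$ is the minimum size of such a set. An edge leak is an edge $xy$ across which no force may be performed (neither $x\rightarrow y$ nor $y\rightarrow x$). A specified leak $x\rightarrow y$ (for adjacent $x,y$) prohibits the single force of $x$ forcing $y$. These are collectively called leaks. A set $B$ is a mixed $\ell$-leaky forcing set if $B$ can color all of $G$ blue despite any set of $\ell$ leaks (each being a vertex, edge or specified leak); $\operatorname{Z}^m_{(\ell)}(G)$ is the minimum size of a mixed $\ell$-leaky forcing set. -}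

module Defs where

open import Data.Nat using (ℕ; _≤_)
open import Data.Bool using (Bool; true; false)
open import Data.Fin using (Fin)
open import Data.Fin.Subset using (Subset; _∈_; ∣_∣)
open import Data.Vec using (Vec)
open import Data.Vec.Relation.Unary.Any using (Any)
open import Data.Product using (Σ; _×_; ∃; _,_)
open import Data.Sum using (_⊎_)
open import Relation.Nullary using (¬_)
open import Relation.Binary.PropositionalEquality using (_≡_; _≢_)

record Graph : Set where
  field
    n     : ℕ
    adj   : Fin n → Fin n → Bool
    sym   : ∀ u v → adj u v ≡ adj v u
    irrefl : ∀ v → adj v v ≡ false

open Graph public

Vertex : Graph → Set
Vertex G = Fin (n G)

Adj : (G : Graph) → Vertex G → Vertex G → Set
Adj G u v = adj G u v ≡ true

-- The set of vertices that end up blue when the color-change rule is applied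
-- exhaustively from B, where a force u → v is prohibited whenever Forb u v holds.
-- (Least set containing B closed under allowed forces.)
data Blue (G : Graph) (B : Subset (n G)) (Forb : Vertex G → Vertex G → Set)
     : Vertex G → Set where
  init  : ∀ {v} → v ∈ B → Blue G B Forb v
  force : ∀ u v → Adj G u v → ¬ Forb u v → Blue G B Forb u
        → (∀ w → Adj G u w → w ≢ v → Blue G B Forb w)
        → Blue G B Forb v

Forces : (G : Graph) → Subset (n G) → (Vertex G → Vertex G → Set) → Set
Forces G B Forb = ∀ v → Blue G B Forb v

VertexLeakForb : (G : Graph) {ℓ : ℕ} → Vec (Vertex G) ℓ → Vertex G → Vertex G → Set
VertexLeakForb G L u v = Any (u ≡_) L

LeakyForcing : (G : Graph) → ℕ → Subset (n G) → Set
LeakyForcing G ℓ B = (L : Vec (Vertex G) ℓ) → Forces G B (VertexLeakForb G L)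

data Leak (G : Graph) : Set where
  vertexLeak    : Vertex G → Leak G
  edgeLeak      : (x y : Vertex G) → Adj G x y → Leak G
  specifiedLeak : (x y : Vertex G) → Adj G x y → Leak G

Prohibits : (G : Graph) → Leak G → Vertex G → Vertex G → Set
Prohibits G (vertexLeak x)        u v = u ≡ x
Prohibits G (edgeLeak x y _)      u v = (u ≡ x × v ≡ y) ⊎ (u ≡ y × v ≡ x)
Prohibits G (specifiedLeak x y _) u v = u ≡ x × v ≡ y

MixedLeakForb : (G : Graph) {ℓ : ℕ} → Vec (Leak G) ℓ → Vertex G → Vertex G → Set
MixedLeakForb G L u v = Any (λ x → Prohibits G x u v) L

MixedLeakyForcing : (G : Graph) → ℕ → Subset (n G) → Set
MixedLeakyForcing G ℓ B = (L : Vec (Leak G) ℓ) → Forces G B (MixedLeakForb G L)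

IsMinimum : (G : Graph) → (Subset (n G) → Set) → ℕ → Set
IsMinimum G P k = (Σ (Subset (n G)) λ B → P B × ∣ B ∣ ≡ k)
                × (∀ B → P B → k ≤ ∣ B ∣)

LeakyForcingNumberIs : (G : Graph) → ℕ → ℕ → Set
LeakyForcingNumberIs G ℓ k = IsMinimum G (LeakyForcing G ℓ) k

MixedLeakyForcingNumberIs : (G : Graph) → ℕ → ℕ → Set
MixedLeakyForcingNumberIs G ℓ k = IsMinimum G (MixedLeakyForcing G ℓ) k

module Submission where

open import Defs
open import Data.Nat using (ℕ)
open import Data.Product using (_×_; _,_; proj₁; proj₂)
open import Data.Fin.Subset using (Subset)
open import Data.Fin using (_≟_)
open import Data.Fin.Properties using (sequence)
open import Data.Bool using (true)
import Data.Bool.Properties as Bool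
open import Data.Sum using (_⊎_; inj₁; inj₂; [_,_]; map₁; map₂; swap; assocˡ)
import Data.Sum.Effectful.Right as SumRight
open import Data.Empty using (⊥-elim)
import Data.Empty.Polymorphic as Polymorphic
open import Data.Vec using (Vec; []; _∷_; map)
open import Data.Vec.Relation.Unary.Any using (here; there; toSum)
open import Data.Vec.Relation.Unary.Any.Properties using (map⁺)
open import Function using (_∘_; id)
open import Function.Bundles using (_⇔_; mk⇔)
open import Level using (0ℓ)
open import Relation.Binary.Core using (Rel; _⇒_)
open import Relation.Binary.Construct.Union using (_∪_)
open import Relation.Binary.Construct.Never using (Never)
open import Relation.Nullary using (¬_; yes; no)
open import Relation.Nullary.Decidable using (_×-dec_)
open import Relation.Binary.PropositionalEquality using (_≡_; _≢_; refl)

-- Each kind of leak is at most as harmful as the worse of the vertex leaks at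
-- its endpoints, on top of any other prohibitions.  For a specified leak
-- x → y this is immediate, since a vertex leak at x prohibits more.  For an
-- edge leak xy, run the process with a vertex leak at x and simulate it with
-- the edge leak instead: the only force that cannot be copied is y → x, and it
-- needs y to be blue already.  So the edge-leak process colours x or y; once
-- it colours x (say), it can copy every force of the vertex-leak-at-x process,
-- because any force into x is simply dropped.  Replacing the leaks one at a
-- time turns ℓ mixed leaks into ℓ vertex leaks.

Prohibition : Graph → Set₁
Prohibition G = Rel (Vertex G) 0ℓ

module _ {G : Graph} {B : Subset (n G)} where

  blue-antimono : {F F′ : Prohibition G} → F′ ⇒ F
                → ∀ {v} → Blue G B F v → Blue G B F′ v
  blue-antimono F′⇒F (init v∈B) = init v∈B
  blue-antimono F′⇒F (force u v uv ¬Fuv bu rest) =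
    force u v uv (¬Fuv ∘ F′⇒F) (blue-antimono F′⇒F bu)
          (λ w uw w≢v → blue-antimono F′⇒F (rest w uw w≢v))

  forces-antimono : {F F′ : Prohibition G} → F′ ⇒ F → Forces G B F → Forces G B F′
  forces-antimono F′⇒F forces v = blue-antimono F′⇒F (forces v)

AcrossEdge : (G : Graph) → Vertex G → Vertex G → Prohibition G
AcrossEdge G x y u v = (u ≡ x × v ≡ y) ⊎ (u ≡ y × v ≡ x)

module EdgeLeak {G : Graph} {B : Subset (n G)} (H : Prohibition G) (x y : Vertex G) where

  private
    LeakAtX LeakXY : Prohibition G
    LeakAtX = H ∪ Prohibits G (vertexLeak x)
    LeakXY  = H ∪ AcrossEdge G x y

  allowed : ∀ {u v} → ¬ LeakAtX u v → ¬ (u ≡ y × v ≡ x) → ¬ LeakXY u v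
  allowed ¬leak _   (inj₁ h)                = ¬leak (inj₁ h)
  allowed ¬leak _   (inj₂ (inj₁ (u≡x , _))) = ¬leak (inj₂ u≡x)
  allowed _     ¬yx (inj₂ (inj₂ y→x))       = ¬yx y→x

  blue-once-x-blue : Blue G B LeakXY x → ∀ {v} → Blue G B LeakAtX v → Blue G B LeakXY v
  blue-once-x-blue bx (init v∈B) = init v∈B
  blue-once-x-blue bx (force u v uv ¬leak bu rest) with v ≟ x
  ... | yes refl = bx
  ... | no v≢x   = force u v uv (allowed ¬leak (v≢x ∘ proj₂)) (blue-once-x-blue bx bu)
                         (λ w uw w≢v → blue-once-x-blue bx (rest w uw w≢v))

  -- The neighbours' cases are combined by finite choice over Fin n:
  -- (∀ w → P w ⊎ Q) → (∀ w → P w) ⊎ Q, i.e. sequence for the applicative _⊎ Q.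
  blue-or-y-blue : ∀ {v} → Blue G B LeakAtX v → Blue G B LeakXY v ⊎ Blue G B LeakXY y
  blue-or-y-blue (init v∈B) = inj₁ (init v∈B)
  blue-or-y-blue (force u v uv ¬leak bu rest)
    with blue-or-y-blue bu | sequence (SumRight.applicative 0ℓ _) neighbour
    where
    neighbour : ∀ w → (Adj G u w → w ≢ v → Blue G B LeakXY w) ⊎ Blue G B LeakXY y
    neighbour w with adj G u w Bool.≟ true | w ≟ v
    ... | no ¬uw | _        = inj₁ (λ uw → ⊥-elim (¬uw uw))
    ... | yes _  | yes refl = inj₁ (λ _ w≢w → ⊥-elim (w≢w refl))
    ... | yes uw | no w≢v   = map₁ (λ bw _ _ → bw) (blue-or-y-blue (rest w uw w≢v))
  ... | inj₂ by  | _       = inj₂ by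
  ... | inj₁ _   | inj₂ by = inj₂ by
  ... | inj₁ bu′ | inj₁ rest′ with (u ≟ y) ×-dec (v ≟ x)
  ...   | yes (refl , refl) = inj₂ bu′
  ...   | no ¬y→x = inj₁ (force u v uv (allowed ¬leak ¬y→x) bu′ rest′)

forces-despite-edgeLeak : ∀ {G B} (H : Prohibition G) (x y : Vertex G)
                        → Forces G B (H ∪ Prohibits G (vertexLeak x))
                        → Forces G B (H ∪ Prohibits G (vertexLeak y))
                        → Forces G B (H ∪ AcrossEdge G x y)
forces-despite-edgeLeak H x y forcesX forcesY with EdgeLeak.blue-or-y-blue H x y (forcesX x)
... | inj₁ bx = λ v → EdgeLeak.blue-once-x-blue H x y bx (forcesX v)
... | inj₂ by = λ v → blue-antimono (map₂ swap)
                  (EdgeLeak.blue-once-x-blue H y x (blue-antimono (map₂ swap) by) (forcesY v))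

forces-despite-leak : ∀ {G B} (H : Prohibition G)
                    → (∀ x → Forces G B (H ∪ Prohibits G (vertexLeak x)))
                    → (l : Leak G) → Forces G B (H ∪ Prohibits G l)
forces-despite-leak H forcesAt (vertexLeak x)        = forcesAt x
forces-despite-leak H forcesAt (edgeLeak x y _)      = forces-despite-edgeLeak H x y (forcesAt x) (forcesAt y)
forces-despite-leak H forcesAt (specifiedLeak x y _) = forces-antimono (map₂ proj₁) (forcesAt x)

forces-despite-mixedLeaks : ∀ {G B ℓ} (H : Prohibition G)
                          → (∀ (L : Vec (Vertex G) ℓ) → Forces G B (H ∪ VertexLeakForb G L))
                          → (L : Vec (Leak G) ℓ) → Forces G B (H ∪ MixedLeakForb G L)
forces-despite-mixedLeaks H forcesVertex [] = forces-antimono (map₂ λ ()) (forcesVertex [])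
forces-despite-mixedLeaks {G} H forcesVertex (l ∷ L) =
  forces-antimono (assocˡ ∘ map₂ toSum)
    (forces-despite-mixedLeaks (H ∪ Prohibits G l) forcesVertex′ L)
  where
  forcesVertex′ : ∀ L′ → Forces _ _ ((H ∪ Prohibits G l) ∪ VertexLeakForb G L′)
  forcesVertex′ L′ =
    forces-antimono [ map₁ inj₁ , inj₁ ∘ inj₂ ]
      (forces-despite-leak (H ∪ VertexLeakForb G L′)
        (λ x → forces-antimono [ map₂ there , inj₂ ∘ here ] (forcesVertex (x ∷ L′))) l)

module _ {G : Graph} {ℓ : ℕ} {B : Subset (n G)} where

  leaky⇒mixedLeaky : LeakyForcing G ℓ B → MixedLeakyForcing G ℓ B
  leaky⇒mixedLeaky leaky L =
    forces-antimono inj₂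
      (forces-despite-mixedLeaks Never
        (λ L′ → forces-antimono [ Polymorphic.⊥-elim , id ] (leaky L′)) L)

  mixedLeaky⇒leaky : MixedLeakyForcing G ℓ B → LeakyForcing G ℓ B
  mixedLeaky⇒leaky mixed L = forces-antimono map⁺ (mixed (map vertexLeak L))

IsMinimum-resp : ∀ {G k} {P Q : Subset (n G) → Set}
               → (∀ {B} → P B → Q B) → (∀ {B} → Q B → P B) → IsMinimum G P k → IsMinimum G Q k
IsMinimum-resp P⇒Q Q⇒P ((B , PB , ∣B∣≡k) , minimal) =
  (B , P⇒Q PB , ∣B∣≡k) , λ B′ → minimal B′ ∘ Q⇒P

corollary4p3 : (G : Graph) (ℓ : ℕ)
    → ((k : ℕ) → LeakyForcingNumberIs G ℓ k ⇔ MixedLeakyForcingNumberIs G ℓ k)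
    × ((B : Subset (n G)) → LeakyForcing G ℓ B ⇔ MixedLeakyForcing G ℓ B)
corollary4p3 G ℓ =
    (λ k → mk⇔ (IsMinimum-resp {G} leaky⇒mixedLeaky mixedLeaky⇒leaky)
               (IsMinimum-resp {G} mixedLeaky⇒leaky leaky⇒mixedLeaky))
  , (λ B → mk⇔ leaky⇒mixedLeaky mixedLeaky⇒leaky)
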